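{- Let $n$ be a positive integer and let $P_n$ be a path on $n$ vertices with an arbitrary total order on its vertices. Then $R_o(P_n,P_n)\le 2^{\lceil\log_2(n)\rceil\cdot(\lceil\log_2(n)\rceil+1)}$.
   Context: An ordered graph is a graph together with a total order on its vertices. An ordered graph $G$ is contained in an ordered graph $H$ if there is an injective map from the vertices of $G$ to the vertices of $H$ that preserves the order and maps edges to edges. The ordered Ramsey number $R_o(F,G)$ of ordered graphs $F$ and $G$ is the smallest $N$ such that every colouring of the edges of the ordered complete graph on $N$ vertices with the colours blue and red contains a blue copy of $F$ or a red copy of $G$. -}

module Defs where

open import Data.Nat using (ℕ; suc; _<_; _≤_)
open import Data.Fin using (Fin; toℕ; inject₁) renaming (suc to fsuc; _<_ to _<ᶠ_)
open import Data.Bool using (Bool; true; false)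
open import Data.Product using (Σ; ∃; _×_; _,_)
open import Data.Sum using (_⊎_; inj₁; inj₂)
open import Data.Empty using (⊥)
open import Relation.Binary.PropositionalEquality using (_≡_; cong; sym; trans)
open import Data.Nat.Properties using (1+n≢n)
open import Function.Bundles using (_↔_; Inverse)

-- An ordered graph on n vertices: vertex set Fin n with its natural order,
-- together with an (undirected, loopless) edge relation.
record OrderedGraph (n : ℕ) : Set₁ where
  field
    Adj   : Fin n → Fin n → Set
    adj-sym : ∀ {u v} → Adj u v → Adj v u
    adj-irrefl : ∀ {u} → Adj u u → ⊥
open OrderedGraph public

-- Colours: true = blue, false = red. A 2-colouring of the edges of the ordered
-- complete graph K_N: the colour of edge {u,v} with u < v is c u v
-- (values of c off the strict upper triangle are irrelevant).
Colouring : ℕ → Set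
Colouring N = Fin N → Fin N → Bool

MonoCopy : ∀ {n N} → OrderedGraph n → Colouring N → Bool → Set
MonoCopy {n} {N} G c b =
  Σ (Fin n → Fin N) λ f →
    (∀ u v → u <ᶠ v → f u <ᶠ f v) ×
    (∀ u v → u <ᶠ v → Adj G u v → c (f u) (f v) ≡ b)

-- R_o(F, G) ≤ N : every red/blue colouring of the ordered K_N contains a blue
-- copy of F or a red copy of G. (Since containment in K_N is monotone in N,
-- this is exactly "the smallest such N is at most N".)
OrdRamseyLE : ∀ {n m} → OrderedGraph n → OrderedGraph m → ℕ → Set
OrdRamseyLE {n} {m} F G N =
  (c : Colouring N) → MonoCopy F c true ⊎ MonoCopy G c false

-- The ordered path P_n with an arbitrary vertex order: the path's i-th vertex
-- (i = 0..n-1) is placed at position σ i of the order, for a bijection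
-- σ : Fin n ↔ Fin n.
PathAdj : ∀ {n} → (Fin n ↔ Fin n) → Fin n → Fin n → Set
PathAdj {n} σ u v =
  Σ (Fin n) λ i → Σ (Fin n) λ j → toℕ j ≡ suc (toℕ i) ×
    ((u ≡ Inverse.to σ i × v ≡ Inverse.to σ j) ⊎
     (u ≡ Inverse.to σ j × v ≡ Inverse.to σ i))

private
  toInj : ∀ {n} (σ : Fin n ↔ Fin n) {x y : Fin n} → Inverse.to σ x ≡ Inverse.to σ y → x ≡ y
  toInj σ {x} {y} e = trans (sym (Inverse.strictlyInverseʳ σ x)) (trans (cong (Inverse.from σ) e) (Inverse.strictlyInverseʳ σ y))

  pathSym : ∀ {n} (σ : Fin n ↔ Fin n) {u v : Fin n} → PathAdj σ u v → PathAdj σ v u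
  pathSym σ (i , j , e , inj₁ (p , q)) = i , j , e , inj₂ (q , p)
  pathSym σ (i , j , e , inj₂ (p , q)) = i , j , e , inj₁ (q , p)

  pathIrr : ∀ {n} (σ : Fin n ↔ Fin n) {u : Fin n} → PathAdj σ u u → ⊥
  pathIrr σ (i , j , e , inj₁ (p , q)) =
    1+n≢n {toℕ i} (trans (sym e) (cong toℕ (toInj σ (trans (sym q) p))))
  pathIrr σ (i , j , e , inj₂ (p , q)) =
    1+n≢n {toℕ i} (trans (sym e) (cong toℕ (toInj σ (trans (sym p) q))))

OrderedPath : ∀ {n} → (Fin n ↔ Fin n) → OrderedGraph n
OrderedPath σ = record { Adj = PathAdj σ ; adj-sym = pathSym σ ; adj-irrefl = pathIrr σ }

-- Split a sorted set V of (2n)^j vertices into n consecutive blocks of 2M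
-- vertices, M = (2n)^(j-1), block p reserved for the path vertex at position p.
-- Walk along the path, keeping in each block the vertices joined in blue to a
-- surviving vertex of the previous block.  If every block keeps M survivors, a
-- blue copy of P_n is traced back from the last one.  Otherwise some block
-- keeps fewer than M, so M of its vertices are joined in red to all of the
-- (at least M) survivors of the previous block: a red complete bipartite pair
-- of ordered sets of size M.  Recursing into both sides doubles the size of a
-- red clique at each of the j levels, so with (2n)^k vertices, k = ⌈log₂ n⌉,
-- we obtain either a blue P_n or a red clique on 2^k ≥ n vertices, which
-- contains every ordered graph on n vertices.  Finally (2n)^k ≤ 2^(k(k+1)).
module Submission where

open import Defs
open import Data.Nat using (ℕ; zero; suc; _*_; _^_; _+_; _∸_; _≤_; _<_; z≤n; s≤s; NonZero; _≤?_; ⌈_/2⌉)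
open import Data.Nat.Properties
open import Data.Nat.DivMod using (_mod_; m<n⇒m%n≡m)
open import Data.Nat.Logarithm using (⌈log₂_⌉)
open import Data.Nat.Logarithm.Core using (⌈log2⌉)
open import Induction.WellFounded using (Acc; acc)
open import Data.Fin using (Fin; toℕ; fromℕ<) renaming (zero to fzero; suc to fsuc; _<_ to _<ᶠ_)
open import Data.Fin.Properties using (toℕ-fromℕ<; toℕ-injective; toℕ<n) renaming (_<?_ to _<ᶠ?_; <-cmp to <ᶠ-cmp)
open import Data.Bool using (Bool; true; false)
open import Data.Bool.Properties using (¬-not) renaming (_≟_ to _≟ᵇ_)
open import Data.List using (List; []; _∷_; _++_; length; take; drop; filter; lookup)
open import Data.List.Properties using (take++drop≡id; length-take; length-drop; length-++; length-tabulate)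
open import Data.List.Relation.Unary.Any using (Any; any?)
open import Data.List.Relation.Unary.All as All using ([]; _∷_)
open import Data.List.Relation.Unary.All.Properties using (++⁻ʳ; ¬Any⇒All¬)
open import Data.List.Relation.Unary.AllPairs using (AllPairs; []; _∷_)
import Data.List.Relation.Unary.AllPairs.Properties as AllPairs
open import Data.List.Membership.Propositional using (_∈_; find)
open import Data.List.Membership.Propositional.Properties using (∈-filter⁻; ∈-lookup; ∈-++⁻)
open import Data.List.Relation.Binary.Subset.Propositional using (_⊆_)
open import Data.List.Relation.Binary.Subset.Propositional.Properties using (xs⊆xs++ys; xs⊆ys++xs; filter-⊆)
open import Data.List.Relation.Ternary.Interleaving.Properties using (interleave-length)
import Data.List.Relation.Ternary.Interleaving.Propositional.Properties as Interleaving
open import Data.Product using (∃; _×_; _,_; proj₁; proj₂)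
open import Data.Sum as Sum using (_⊎_; inj₁; inj₂)
open import Data.Empty using (⊥-elim)
open import Relation.Nullary using (Dec; yes; no; ¬?)
open import Relation.Binary using (tri<; tri≈; tri>)
open import Relation.Binary.PropositionalEquality using (_≡_; _≢_; refl; cong; sym; trans; subst; subst₂; cong₂; module ≡-Reasoning)
open import Function using (_∘_; id)
open import Function.Properties.Inverse using (↔⇒↣)
open import Function.Bundles using (_↔_; Inverse; Injection)

n≤2^⌈log2⌉n : ∀ n (rec : Acc _<_ n) → n ≤ 2 ^ ⌈log2⌉ n rec
n≤2^⌈log2⌉n zero _ = z≤n
n≤2^⌈log2⌉n (suc zero) _ = ≤-refl
n≤2^⌈log2⌉n (suc (suc n)) (acc rs) = begin
  2 + n                ≤⟨ +-monoʳ-≤ 2 n≤2⌈n/2⌉ ⟩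
  2 + 2 * ⌈ n /2⌉      ≡⟨ sym (*-distribˡ-+ 2 1 ⌈ n /2⌉) ⟩
  2 * suc ⌈ n /2⌉      ≤⟨ *-monoʳ-≤ 2 (n≤2^⌈log2⌉n (suc ⌈ n /2⌉) _) ⟩
  2 ^ ⌈log2⌉ (suc (suc n)) (acc rs) ∎
  where
  open ≤-Reasoning
  n≤2⌈n/2⌉ : n ≤ 2 * ⌈ n /2⌉
  n≤2⌈n/2⌉ = begin
    n                      ≡⟨ sym (⌊n/2⌋+⌈n/2⌉≡n n) ⟩
    _ + ⌈ n /2⌉            ≤⟨ +-monoˡ-≤ ⌈ n /2⌉ (⌊n/2⌋≤⌈n/2⌉ n) ⟩
    ⌈ n /2⌉ + ⌈ n /2⌉      ≡⟨ cong (⌈ n /2⌉ +_) (sym (+-identityʳ ⌈ n /2⌉)) ⟩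
    2 * ⌈ n /2⌉            ∎

n≤2^⌈log₂n⌉ : ∀ n → n ≤ 2 ^ ⌈log₂ n ⌉
n≤2^⌈log₂n⌉ n = n≤2^⌈log2⌉n n _

[2n]^⌈log₂n⌉≤2^[⌈log₂n⌉*[⌈log₂n⌉+1]] : ∀ n → (2 * n) ^ ⌈log₂ n ⌉ ≤ 2 ^ (⌈log₂ n ⌉ * (⌈log₂ n ⌉ + 1))
[2n]^⌈log₂n⌉≤2^[⌈log₂n⌉*[⌈log₂n⌉+1]] n = begin
  (2 * n) ^ k         ≤⟨ ^-monoˡ-≤ k (*-monoʳ-≤ 2 (n≤2^⌈log₂n⌉ n)) ⟩
  (2 ^ suc k) ^ k     ≡⟨ ^-*-assoc 2 (suc k) k ⟩
  2 ^ (suc k * k)     ≡⟨ cong (2 ^_) (trans (*-comm (suc k) k) (cong (k *_) (+-comm 1 k))) ⟩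
  2 ^ (k * (k + 1))   ∎
  where
  open ≤-Reasoning
  k = ⌈log₂ n ⌉

module _ {A : Set} {R : A → A → Set} where

  AllPairs-++-cross : ∀ xs {ys} → AllPairs R (xs ++ ys) → ∀ {x y} → x ∈ xs → y ∈ ys → R x y
  AllPairs-++-cross (_ ∷ xs) (Rx ∷ _) (Any.here refl) y∈ys = All.lookup (++⁻ʳ xs Rx) y∈ys
  AllPairs-++-cross (_ ∷ xs) (_ ∷ Rxs) (Any.there x∈xs) y∈ys = AllPairs-++-cross xs Rxs x∈xs y∈ys

  AllPairs-take-drop : ∀ L {W} → AllPairs R W → ∀ {x y} → x ∈ take L W → y ∈ drop L W → R x y
  AllPairs-take-drop L {W} RW =
    AllPairs-++-cross (take L W) (subst (AllPairs R) (sym (take++drop≡id L W)) RW)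

  AllPairs-lookup : ∀ {xs} → AllPairs R xs → ∀ {i j : Fin (length xs)} → i <ᶠ j → R (lookup xs i) (lookup xs j)
  AllPairs-lookup (Rx ∷ _) {fzero} {fsuc j} _ = All.lookup Rx (∈-lookup j)
  AllPairs-lookup (_ ∷ Rxs) {fsuc i} {fsuc j} (s≤s i<j) = AllPairs-lookup Rxs i<j

take-⊆ : ∀ {A : Set} L (W : List A) → take L W ⊆ W
take-⊆ L W = subst (take L W ⊆_) (take++drop≡id L W) (xs⊆xs++ys (take L W) (drop L W))

drop-⊆ : ∀ {A : Set} L (W : List A) → drop L W ⊆ W
drop-⊆ L W = subst (drop L W ⊆_) (take++drop≡id L W) (xs⊆ys++xs (drop L W) (take L W))

block : ∀ {A : Set} → ℕ → List A → (q : ℕ) → Fin q → List A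
block L W (suc q) fzero = take L W
block L W (suc q) (fsuc b) = block L (drop L W) q b

module _ {A : Set} (L : ℕ) where

  block-⊆ : ∀ (W : List A) q b → block L W q b ⊆ W
  block-⊆ W (suc q) fzero = take-⊆ L W
  block-⊆ W (suc q) (fsuc b) = drop-⊆ L W ∘ block-⊆ (drop L W) q b

  block-sorted : ∀ {R : A → A → Set} {W} q b → AllPairs R W → AllPairs R (block L W q b)
  block-sorted (suc q) fzero RW = AllPairs.take⁺ L RW
  block-sorted (suc q) (fsuc b) RW = block-sorted q b (AllPairs.drop⁺ L RW)

  length-block : ∀ (W : List A) q b → q * L ≤ length W → L ≤ length (block L W q b)
  length-block W (suc q) fzero qL≤ = ≤-reflexive (sym (trans (length-take L W) (m≤n⇒m⊓n≡m L≤W)))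
    where L≤W = ≤-trans (m≤m+n L (q * L)) qL≤
  length-block W (suc q) (fsuc b) qL≤ = length-block (drop L W) q b
    (subst (q * L ≤_) (sym (length-drop L W))
      (m+n≤o⇒m≤o∸n (q * L) (≤-trans (≤-reflexive (+-comm (q * L) L)) qL≤)))

  block-precedes : ∀ {R : A → A → Set} {W} q {b b'} → AllPairs R W → b <ᶠ b' →
                   ∀ {x y} → x ∈ block L W q b → y ∈ block L W q b' → R x y
  block-precedes {W = W} (suc q) {fzero} {fsuc b'} RW _ x∈ y∈ =
    AllPairs-take-drop L RW x∈ (block-⊆ (drop L W) q b' y∈)
  block-precedes (suc q) {fsuc b} {fsuc b'} RW (s≤s b<b') =
    block-precedes q (AllPairs.drop⁺ L RW) b<b'

module _ {A : Set} (_≺_ R : A → A → Set) where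

  record Biclique (M : ℕ) (V : List A) : Set where
    field
      left right : List A
      left-sorted : AllPairs _≺_ left
      right-sorted : AllPairs _≺_ right
      left-large : M ≤ length left
      right-large : M ≤ length right
      left-⊆ : left ⊆ V
      right-⊆ : right ⊆ V
      complete : ∀ {x y} → x ∈ left → y ∈ right → R x y

  record Clique (s : ℕ) (V : List A) : Set where
    field
      members : List A
      pairwise : AllPairs R members
      large : s ≤ length members
      members-⊆ : members ⊆ V

  merge-cliques : ∀ {M s V} (B : Biclique M V) →
                  Clique s (Biclique.left B) → Clique s (Biclique.right B) → Clique (2 * s) V
  merge-cliques B KX KY = record
    { members = X ++ Y
    ; pairwise = AllPairs.++⁺ (Clique.pairwise KX) (Clique.pairwise KY)
        (All.tabulate λ x∈ → All.tabulate λ y∈ →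
          Biclique.complete B (Clique.members-⊆ KX x∈) (Clique.members-⊆ KY y∈))
    ; large = ≤-trans (+-mono-≤ (Clique.large KX) (≤-trans (≤-reflexive (+-identityʳ _)) (Clique.large KY)))
                      (≤-reflexive (sym (length-++ X)))
    ; members-⊆ = λ z∈ → Sum.[ Biclique.left-⊆ B ∘ Clique.members-⊆ KX
                            , Biclique.right-⊆ B ∘ Clique.members-⊆ KY ] (∈-++⁻ X z∈)
    }
    where
    X = Clique.members KX
    Y = Clique.members KY

  module _ {P : Set} (d : ℕ) .{{_ : NonZero d}}
           (split : ∀ {M V} → 0 < M → AllPairs _≺_ V → d * M ≤ length V → P ⊎ Biclique M V) where

    bicliques⇒clique : ∀ j {V} → AllPairs _≺_ V → d ^ j ≤ length V → P ⊎ Clique (2 ^ j) V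
    bicliques⇒clique zero {v ∷ _} _ _ =
      inj₂ (record { members = v ∷ [] ; pairwise = [] ∷ [] ; large = ≤-refl
                   ; members-⊆ = λ { (Any.here refl) → Any.here refl } })
    bicliques⇒clique (suc j) sV large with split (m^n>0 d j) sV large
    ... | inj₁ p = inj₁ p
    ... | inj₂ B with bicliques⇒clique j (Biclique.left-sorted B) (Biclique.left-large B)
    ...   | inj₁ p = inj₁ p
    ...   | inj₂ KX with bicliques⇒clique j (Biclique.right-sorted B) (Biclique.right-large B)
    ...     | inj₁ p = inj₁ p
    ...     | inj₂ KY = inj₂ (merge-cliques B KX KY)

MonoEdge : ∀ {N} → Colouring N → Bool → Fin N → Fin N → Set
MonoEdge c b x y = x <ᶠ y × c x y ≡ b

monoCopy-in-clique : ∀ {n N} (G : OrderedGraph n) {c : Colouring N} {b : Bool} {K : List (Fin N)} →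
                     AllPairs (MonoEdge c b) K → n ≤ length K → MonoCopy G c b
monoCopy-in-clique {n} {N} G {c} {b} {K} monoK n≤K =
  f , (λ u v u<v → proj₁ (mono u<v)) , (λ u v u<v _ → proj₂ (mono u<v))
  where
  index : Fin n → Fin (length K)
  index u = fromℕ< (≤-trans (toℕ<n u) n≤K)
  f : Fin n → Fin N
  f = lookup K ∘ index
  mono : ∀ {u v} → u <ᶠ v → MonoEdge c b (f u) (f v)
  mono u<v = AllPairs-lookup monoK (subst₂ _<_ (sym (toℕ-fromℕ< _)) (sym (toℕ-fromℕ< _)) u<v)

-- A colouring is only read above the diagonal; this is the colour of {x, y} for x ≢ y.
edgeColour : ∀ {N} → Colouring N → Fin N → Fin N → Bool
edgeColour c x y with x <ᶠ? y
... | yes _ = c x y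
... | no _ = c y x

module _ {N} (c : Colouring N) where

  edgeColour-< : ∀ {x y} → x <ᶠ y → edgeColour c x y ≡ c x y
  edgeColour-< {x} {y} x<y with x <ᶠ? y
  ... | yes _ = refl
  ... | no x≮y = ⊥-elim (x≮y x<y)

  edgeColour-> : ∀ {x y} → y <ᶠ x → edgeColour c x y ≡ c y x
  edgeColour-> {x} {y} y<x with x <ᶠ? y
  ... | yes x<y = ⊥-elim (<-asym x<y y<x)
  ... | no _ = refl

module PathOrBiclique {n N : ℕ} (σ : Fin (suc n) ↔ Fin (suc n)) (c : Colouring N)
                      {M : ℕ} (M>0 : 0 < M) {V : List (Fin N)} (V-sorted : AllPairs _<ᶠ_ V)
                      (V-large : 2 * suc n * M ≤ length V) where

  open Inverse σ using (to; from; strictlyInverseˡ; strictlyInverseʳ)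

  Sorted : List (Fin N) → Set
  Sorted = AllPairs _<ᶠ_

  RedBiclique : Set
  RedBiclique = Biclique _<ᶠ_ (MonoEdge c false) M V

  BluePath : Set
  BluePath = MonoCopy (OrderedPath σ) c true

  -- Where the i-th path vertex sits in the vertex order; mod only makes this
  -- total, it is used for i ≤ n.
  position : ℕ → Fin (suc n)
  position i = to (i mod suc n)

  toℕ-mod : ∀ {i} → i < suc n → toℕ (i mod suc n) ≡ i
  toℕ-mod i<n = trans (toℕ-fromℕ< _) (m<n⇒m%n≡m i<n)

  position-toℕ : ∀ i → position (toℕ i) ≡ to i
  position-toℕ i = cong to (toℕ-injective (toℕ-mod (toℕ<n i)))

  position-step : ∀ {m} → suc m < suc n → position m ≢ position (suc m)
  position-step {m} m<n eq = 1+n≢n (begin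
    suc m                       ≡⟨ sym (toℕ-mod m<n) ⟩
    toℕ (suc m mod suc n)       ≡⟨ cong toℕ (sym (Injection.injective (↔⇒↣ σ) eq)) ⟩
    toℕ (m mod suc n)           ≡⟨ toℕ-mod (<-trans (n<1+n m) m<n) ⟩
    m                           ∎)
    where open ≡-Reasoning

  blockAt : Fin (suc n) → List (Fin N)
  blockAt = block (2 * M) V (suc n)

  blockAt-sorted : ∀ p → Sorted (blockAt p)
  blockAt-sorted p = block-sorted (2 * M) (suc n) p V-sorted

  length-blockAt : ∀ p → 2 * M ≤ length (blockAt p)
  length-blockAt p = length-block (2 * M) V (suc n) p (begin
    suc n * (2 * M)   ≡⟨ sym (*-assoc (suc n) 2 M) ⟩
    suc n * 2 * M     ≡⟨ cong (_* M) (*-comm (suc n) 2) ⟩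
    2 * suc n * M     ≤⟨ V-large ⟩
    length V          ∎)
    where open ≤-Reasoning

  BlueTo : List (Fin N) → Fin N → Set
  BlueTo S y = Any (λ x → edgeColour c x y ≡ true) S

  blueTo? : ∀ S y → Dec (BlueTo S y)
  blueTo? S y = any? (λ x → edgeColour c x y ≟ᵇ true) S

  -- reached m: the vertices of the m-th path block that end a blue walk
  -- through the blocks of path vertices 0, 1, …, m.
  reached : ℕ → List (Fin N)
  reached zero = blockAt (position 0)
  reached (suc m) = filter (blueTo? (reached m)) (blockAt (position (suc m)))

  unreached : ℕ → List (Fin N)
  unreached m = filter (¬? ∘ blueTo? (reached m)) (blockAt (position (suc m)))

  reached-⊆ : ∀ m → reached m ⊆ blockAt (position m)
  reached-⊆ zero x∈ = x∈
  reached-⊆ (suc m) = filter-⊆ (blueTo? (reached m)) _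

  unreached-⊆ : ∀ m → unreached m ⊆ blockAt (position (suc m))
  unreached-⊆ m = filter-⊆ (¬? ∘ blueTo? (reached m)) _

  reached-sorted : ∀ m → Sorted (reached m)
  reached-sorted zero = blockAt-sorted (position 0)
  reached-sorted (suc m) = AllPairs.filter⁺ (blueTo? (reached m)) (blockAt-sorted (position (suc m)))

  unreached-sorted : ∀ m → Sorted (unreached m)
  unreached-sorted m = AllPairs.filter⁺ (¬? ∘ blueTo? (reached m)) (blockAt-sorted (position (suc m)))

  unreached-red : ∀ m {x y} → x ∈ reached m → y ∈ unreached m → edgeColour c x y ≡ false
  unreached-red m x∈ y∈ = ¬-not (All.lookup (¬Any⇒All¬ _ not-blue) x∈)
    where
    not-blue = proj₂ (∈-filter⁻ (¬? ∘ blueTo? (reached m)) {xs = blockAt (position (suc m))} y∈)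

  unreached-large : ∀ m → length (reached (suc m)) < M → M ≤ length (unreached m)
  unreached-large m small = +-cancelˡ-≤ M M (length (unreached m)) (begin
    M + M                                          ≡⟨ cong (M +_) (sym (+-identityʳ M)) ⟩
    2 * M                                          ≤⟨ length-blockAt (position (suc m)) ⟩
    length (blockAt (position (suc m)))
      ≡⟨ interleave-length (Interleaving.filter⁺ (blueTo? (reached m)) (blockAt (position (suc m)))) ⟩
    length (reached (suc m)) + length (unreached m) ≤⟨ +-monoˡ-≤ _ (<⇒≤ small) ⟩
    M + length (unreached m)                       ∎)
    where open ≤-Reasoning

  redBiclique : ∀ {p q X Y} → p ≢ q → X ⊆ blockAt p → Y ⊆ blockAt q → Sorted X → Sorted Y →
                M ≤ length X → M ≤ length Y → (∀ {x y} → x ∈ X → y ∈ Y → edgeColour c x y ≡ false) →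
                RedBiclique
  redBiclique {p} {q} {X} {Y} p≢q X⊆ Y⊆ sX sY lX lY red with <ᶠ-cmp p q
  ... | tri< p<q _ _ = record
    { left = X ; right = Y ; left-sorted = sX ; right-sorted = sY ; left-large = lX ; right-large = lY
    ; left-⊆ = block-⊆ (2 * M) V (suc n) p ∘ X⊆ ; right-⊆ = block-⊆ (2 * M) V (suc n) q ∘ Y⊆
    ; complete = λ x∈ y∈ → let x<y = block-precedes (2 * M) (suc n) V-sorted p<q (X⊆ x∈) (Y⊆ y∈)
                           in x<y , trans (sym (edgeColour-< c x<y)) (red x∈ y∈) }
  ... | tri≈ _ p≡q _ = ⊥-elim (p≢q p≡q)
  ... | tri> _ _ q<p = record
    { left = Y ; right = X ; left-sorted = sY ; right-sorted = sX ; left-large = lY ; right-large = lX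
    ; left-⊆ = block-⊆ (2 * M) V (suc n) q ∘ Y⊆ ; right-⊆ = block-⊆ (2 * M) V (suc n) p ∘ X⊆
    ; complete = λ y∈ x∈ → let y<x = block-precedes (2 * M) (suc n) V-sorted q<p (Y⊆ y∈) (X⊆ x∈)
                           in y<x , trans (sym (edgeColour-> c y<x)) (red x∈ y∈) }

  reached-large-or-biclique : ∀ m → m < suc n → M ≤ length (reached m) ⊎ RedBiclique
  reached-large-or-biclique zero _ = inj₁ (≤-trans (m≤m+n M _) (length-blockAt (position 0)))
  reached-large-or-biclique (suc m) m<n with reached-large-or-biclique m (<-trans (n<1+n m) m<n)
  ... | inj₂ B = inj₂ B
  ... | inj₁ large with M ≤? length (reached (suc m))
  ...   | yes large′ = inj₁ large′
  ...   | no small = inj₂ (redBiclique (position-step m<n) (reached-⊆ m) (unreached-⊆ m)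
                             (reached-sorted m) (unreached-sorted m) large (unreached-large m (≰⇒> small))
                             (unreached-red m))

  previous : ∀ m {y} → y ∈ reached (suc m) → ∃ λ x → x ∈ reached m × edgeColour c x y ≡ true
  previous m y∈ = find (proj₂ (∈-filter⁻ (blueTo? (reached m)) {xs = blockAt (position (suc m))} y∈))

  previous-∈ : ∀ m {y} (y∈ : y ∈ reached (suc m)) → proj₁ (previous m y∈) ∈ reached m
  previous-∈ m y∈ = proj₁ (proj₂ (previous m y∈))

  walkBack : ∀ m {z} → z ∈ reached m → ℕ → Fin N
  walkBack zero {z} _ _ = z
  walkBack (suc m) {z} _ zero = z
  walkBack (suc m) z∈ (suc d) = walkBack m (previous-∈ m z∈) d

  walkBack-zero : ∀ m {z} (z∈ : z ∈ reached m) → walkBack m z∈ 0 ≡ z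
  walkBack-zero zero _ = refl
  walkBack-zero (suc m) _ = refl

  walkBack-∈ : ∀ m {z} (z∈ : z ∈ reached m) d → walkBack m z∈ d ∈ reached (m ∸ d)
  walkBack-∈ zero {z} z∈ d = subst (λ k → z ∈ reached k) (sym (0∸n≡0 d)) z∈
  walkBack-∈ (suc m) z∈ zero = z∈
  walkBack-∈ (suc m) z∈ (suc d) = walkBack-∈ m (previous-∈ m z∈) d

  walkBack-blue : ∀ m {z} (z∈ : z ∈ reached m) d → d < m →
                  edgeColour c (walkBack m z∈ (suc d)) (walkBack m z∈ d) ≡ true
  walkBack-blue (suc m) {z} z∈ zero _ =
    subst (λ w → edgeColour c w z ≡ true) (sym (walkBack-zero m (previous-∈ m z∈)))
      (proj₂ (proj₂ (previous m z∈)))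
  walkBack-blue (suc m) z∈ (suc d) (s≤s d<m) = walkBack-blue m (previous-∈ m z∈) d d<m

  module BluePathThrough {z} (z∈ : z ∈ reached n) where

    walk : ℕ → Fin N
    walk i = walkBack n z∈ (n ∸ i)

    walk-blue : ∀ i → i < n → edgeColour c (walk i) (walk (suc i)) ≡ true
    walk-blue i i<n = subst (λ e → edgeColour c (walkBack n z∈ e) (walk (suc i)) ≡ true)
      (sym n∸i≡1+d) (walkBack-blue n z∈ d d<n)
      where
      d = n ∸ suc i
      -- the left-hand side (1 + n) ∸ suc i of +-∸-assoc reduces to n ∸ i
      n∸i≡1+d : n ∸ i ≡ suc d
      n∸i≡1+d = +-∸-assoc 1 i<n
      d<n : d < n
      d<n = ≤-trans (≤-reflexive (sym n∸i≡1+d)) (m∸n≤m n i)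

    embedding : Fin (suc n) → Fin N
    embedding u = walk (toℕ (from u))

    embedding-∈ : ∀ u → embedding u ∈ blockAt u
    embedding-∈ u = subst (λ p → embedding u ∈ blockAt p) (trans (position-toℕ (from u)) (strictlyInverseˡ u))
      (reached-⊆ i (subst (λ k → embedding u ∈ reached k) (m∸[m∸n]≡n (≤-pred (toℕ<n (from u))))
        (walkBack-∈ n z∈ (n ∸ i))))
      where
      i = toℕ (from u)

    embedding-increasing : ∀ u v → u <ᶠ v → embedding u <ᶠ embedding v
    embedding-increasing u v u<v =
      block-precedes (2 * M) (suc n) V-sorted u<v (embedding-∈ u) (embedding-∈ v)

    path-edge-blue : ∀ i j → toℕ j ≡ suc (toℕ i) → edgeColour c (embedding (to i)) (embedding (to j)) ≡ true
    path-edge-blue i j j≡1+i = begin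
      edgeColour c (embedding (to i)) (embedding (to j))
        ≡⟨ cong₂ (edgeColour c) (on-path i) (trans (on-path j) (cong walk j≡1+i)) ⟩
      edgeColour c (walk (toℕ i)) (walk (suc (toℕ i)))
        ≡⟨ walk-blue (toℕ i) (subst (_≤ n) j≡1+i (≤-pred (toℕ<n j))) ⟩
      true ∎
      where
      open ≡-Reasoning
      on-path : ∀ i → embedding (to i) ≡ walk (toℕ i)
      on-path i = cong (walk ∘ toℕ) (strictlyInverseʳ i)

    bluePath : BluePath
    bluePath = embedding , embedding-increasing , blue
      where
      blue : ∀ u v → u <ᶠ v → PathAdj σ u v → c (embedding u) (embedding v) ≡ true
      blue u v u<v (i , j , j≡1+i , inj₁ (refl , refl)) =
        trans (sym (edgeColour-< c (embedding-increasing u v u<v))) (path-edge-blue i j j≡1+i)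
      blue u v u<v (i , j , j≡1+i , inj₂ (refl , refl)) =
        trans (sym (edgeColour-> c (embedding-increasing u v u<v))) (path-edge-blue i j j≡1+i)

  path-or-biclique : BluePath ⊎ RedBiclique
  path-or-biclique with reached-large-or-biclique n (n<1+n n)
  ... | inj₂ B = inj₂ B
  ... | inj₁ large = inj₁ (BluePathThrough.bluePath (∈-lookup (fromℕ< (≤-trans M>0 large))))

orderedPathRamsey : ∀ {n N} (σ : Fin (suc n) ↔ Fin (suc n)) (c : Colouring N) {V : List (Fin N)} →
                    AllPairs _<ᶠ_ V → (2 * suc n) ^ ⌈log₂ suc n ⌉ ≤ length V →
                    MonoCopy (OrderedPath σ) c true ⊎ MonoCopy (OrderedPath σ) c false
orderedPathRamsey {n} σ c sV large =
  Sum.map₂ (λ K → monoCopy-in-clique (OrderedPath σ) (Clique.pairwise K)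
                    (≤-trans (n≤2^⌈log₂n⌉ (suc n)) (Clique.large K)))
    (bicliques⇒clique _<ᶠ_ (MonoEdge c false) (2 * suc n)
      (λ M>0 sV′ large′ → PathOrBiclique.path-or-biclique σ c M>0 sV′ large′) ⌈log₂ suc n ⌉ sV large)

corollary2p6 : (n : ℕ) → 1 ≤ n → (σ : Fin n ↔ Fin n) →
    OrdRamseyLE (OrderedPath σ) (OrderedPath σ) (2 ^ (⌈log₂ n ⌉ * (⌈log₂ n ⌉ + 1)))
corollary2p6 zero () σ
corollary2p6 (suc n) _ σ c = orderedPathRamsey σ c (AllPairs.tabulate⁺-< id)
  (≤-trans ([2n]^⌈log₂n⌉≤2^[⌈log₂n⌉*[⌈log₂n⌉+1]] (suc n)) (≤-reflexive (sym (length-tabulate id))))
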